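{- Let $m\ge1$ and $t$ integers with $1\le t\le2^{m-1}$, $p=t/2^m$, $n\ge1$, $f:\{0,1\}^n\to\{0,1\}$, and $g=Red(f):\{0,1\}^{mn}\to\{0,1\}$ the reduction defined below. Then \[ \sum_{i=1}^{mn}I_i(g)^2\ \le\ 12p^2\lfloor\log(1/p)\rfloor\sum_{i=1}^nI_i(f)^2, \] where the influences on $f$ are with respect to $\mu_p$ and those on $g$ with respect to the uniform measure $\mu_{1/2}$.
   Context: $\mu_p=(p\delta_{\{1\}}+(1-p)\delta_{\{0\}})^{\otimes n}$. For a function $F$ on $\{0,1\}^N$ with product measure $\mu$, the influence of coordinate $i$ is $I_i(F)=\Pr_{x\sim\mu}[F(x)\ne F(x\oplus e_i)]$, where $x\oplus e_i$ is $x$ with its $i$-th coordinate flipped. $\log$ is base 2. Reduction: write $y\in\{0,1\}^{mn}$ as $y=(y^1,\dots,y^n)$, $y^i\in\{0,1\}^m$ occupying coordinates $(i-1)m+1,\dots,im$. Let $Bin(y^i)=\sum_{j=0}^{m-1}2^jy^i_{m-j}$, $h(y^i)=1$ if $Bin(y^i)\ge2^m-t$ and $0$ otherwise, and $g(y)=f(h(y^1),\dots,h(y^n))$. -}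

module Defs where

open import Data.Bool using (Bool; true; false; not; if_then_else_; _xor_)
open import Data.Nat as ℕ using (ℕ; zero; suc; _∸_; _^_; NonZero; _≤ᵇ_)
open import Data.Nat.Properties using (m^n≢0)
open import Data.Nat.Logarithm using (⌊log₂_⌋)
open import Data.Integer as ℤ using (+_)
open import Data.Fin using (Fin)
open import Data.Vec using (Vec; []; _∷_; updateAt; splitAt; map)
open import Data.List using (List; []; _∷_; _++_; concatMap)
import Data.List as L
open import Data.Product using (proj₁; proj₂)
open import Data.Rational as ℚ using (ℚ; 0ℚ; 1ℚ; _+_; _*_; _-_)

cube : (n : ℕ) → List (Vec Bool n)
cube zero = [] ∷ []
cube (suc n) = L.map (false ∷_) (cube n) ++ L.map (true ∷_) (cube n)

μ : (p : ℚ) {n : ℕ} → Vec Bool n → ℚ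
μ p [] = 1ℚ
μ p (b ∷ x) = (if b then p else (1ℚ - p)) * μ p x

Pr : (p : ℚ) (n : ℕ) → (Vec Bool n → Bool) → ℚ
Pr p n E = L.foldr _+_ 0ℚ (L.map (λ x → if E x then μ p x else 0ℚ) (cube n))

flipAt : {n : ℕ} → Fin n → Vec Bool n → Vec Bool n
flipAt i x = updateAt x i not

Inf : (p : ℚ) (n : ℕ) → (Vec Bool n → Bool) → Fin n → ℚ
Inf p n F i = Pr p n (λ x → F x xor F (flipAt i x))

sumFin : (k : ℕ) → (Fin k → ℚ) → ℚ
sumFin k a = L.foldr _+_ 0ℚ (L.map a (L.allFin k))

sumInfSq : (p : ℚ) (n : ℕ) → (Vec Bool n → Bool) → ℚ
sumInfSq p n F = sumFin n (λ i → Inf p n F i * Inf p n F i)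

-- Bin(y) = Σ_{j=0}^{m-1} 2^j y_{m-j}  (y_1 most significant bit)
bit : Bool → ℕ
bit true = 1
bit false = 0

Bin : {m : ℕ} → Vec Bool m → ℕ
Bin [] = 0
Bin {suc m} (b ∷ y) = bit b ℕ.* 2 ^ m ℕ.+ Bin y

h : (m t : ℕ) → Vec Bool m → Bool
h m t y = (2 ^ m ∸ t) ≤ᵇ Bin y

blocks : (n m : ℕ) → Vec Bool (n ℕ.* m) → Vec (Vec Bool m) n
blocks zero m y = []
blocks (suc n) m y = proj₁ (splitAt m y) ∷ blocks n m (proj₁ (proj₂ (splitAt m y)))

Red : (m t n : ℕ) → (Vec Bool n → Bool) → Vec Bool (n ℕ.* m) → Bool
Red m t n f y = f (map (h m t) (blocks n m y))

pOf : (m t : ℕ) → ℚ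
pOf m t = (+ t ℚ./ (2 ^ m)) {{m^n≢0 2 m}}

-- ⌊log₂ q⌋ for a rational q ≥ 1 (equals ⌊log₂ ⌊q⌋⌋)
⌊log₂ℚ_⌋ : ℚ → ℕ
⌊log₂ℚ q ⌋ = ⌊log₂ ℤ.∣ ℚ.floor q ∣ ⌋

invP : (m t : ℕ) .{{_ : NonZero t}} → ℚ
invP m t = + (2 ^ m) ℚ./ t

-- All probabilities here are counts over finite cubes divided by powers of 2. For a coordinate
-- c = (i, j), bit j of block i, the function g = Red(f) depends on block i only through h(y^i),
-- and h pushes the uniform measure on each other block forward to μ_p; hence the influence
-- factorises exactly: I_{(i,j)}(g) = I_j(h) · I_i(f), with I_j(h) the uniform influence of bit j
-- on h. So Σ_c I_c(g)² = (Σ_j I_j(h)²) · Σ_i I_i(f)². Finally 2^m I_j(h) ≤ 2 min(t, 2^(m-1-j)):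
-- a flip changes h only at the t points of h⁻¹(1) and at their images, and flipping bit j moves
-- Bin(y) by 2^(m-1-j), so it changes h only for the 2^(m-j) values of Bin(y) nearest the
-- threshold. Summing the squares gives Σ_j I_j(h)² ≤ 12 p² ⌊log(1/p)⌋.

module Submission where

open import Defs
open import Data.Bool using (Bool; true; false; not; _xor_; if_then_else_; T)
open import Data.Bool.Properties using (xor-same; xor-comm)
open import Data.Nat using (ℕ; zero; suc; _+_; _*_; _∸_; _^_; _≤_; _<_; _⊓_; _≤ᵇ_; z≤n; s≤s; NonZero; >-nonZero; >-nonZero⁻¹; ≢-nonZero⁻¹)
open import Data.Nat.Properties
open import Data.Nat.DivMod using (_/_; /-congˡ; /-congʳ; m*n/o*n≡m/o; m*n/n≡m; /-monoˡ-≤; m≥n⇒m/n>0; m/n*n≤m)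
open import Data.Nat.Logarithm using (⌊log₂_⌋; ⌊log₂⌋-mono-≤; ⌊log₂[2*b]⌋≡1+⌊log₂b⌋; ⌊log₂[2^n]⌋≡n)
open import Data.Nat.Tactic.RingSolver using (solve-∀)
open import Data.Nat.ListAction using (sum)
open import Data.Nat.ListAction.Properties using (sum-++)
open import Data.Fin using (Fin; zero; suc; toℕ; _↑ˡ_; _↑ʳ_; combine)
open import Data.Fin.Properties using (toℕ<n)
open import Data.Vec using (Vec; []; _∷_; _++_; take; drop)
import Data.Vec as Vec
open import Data.List using (List; map; allFin)
import Data.List as List
open import Data.List.Properties using (map-cong; map-++; map-∘; map-tabulate)
open import Data.Nat.GCD using (gcd; gcd[m,n]≢0)
import Data.Nat.Coprimality as Coprime
import Data.Integer as ℤ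
import Data.Integer.Properties as ℤ
import Data.Integer.DivMod as ℤ
open import Data.Rational as ℚ using (ℚ; mkℚ; ½; 0ℚ; 1ℚ; NonNegative)
import Data.Rational.Properties as ℚ
open import Data.Rational.Unnormalised as ℚᵘ using (mkℚᵘ)
import Data.Rational.Unnormalised.Properties as ℚᵘ
open import Data.Rational.Solver using (module +-*-Solver)
open +-*-Solver using (solve; _:+_; _:*_; _:-_; _:=_)
open import Data.Sum using (inj₂)
open import Function using (_∘_)
open import Relation.Nullary using (Dec; yes; no; contradiction)
open import Relation.Binary.PropositionalEquality
open import Algebra.Properties.CommutativeSemigroup +-commutativeSemigroup using () renaming (interchange to [m+n]+[o+p]≡[m+o]+[n+p])
open import Algebra.Properties.CommutativeSemigroup *-commutativeSemigroup using () renaming (x∙yz≈y∙xz to m*[n*o]≡n*[m*o])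

module _ {A : Set} {f g : A → ℕ} where

  sum-map-cong : (∀ x → f x ≡ g x) → ∀ xs → sum (map f xs) ≡ sum (map g xs)
  sum-map-cong f≗g xs = cong sum (map-cong f≗g xs)

  sum-map-mono : (∀ x → f x ≤ g x) → ∀ xs → sum (map f xs) ≤ sum (map g xs)
  sum-map-mono f≤g List.[] = z≤n
  sum-map-mono f≤g (x List.∷ xs) = +-mono-≤ (f≤g x) (sum-map-mono f≤g xs)

  sum-map-+ : ∀ xs → sum (map (λ x → f x + g x) xs) ≡ sum (map f xs) + sum (map g xs)
  sum-map-+ List.[] = refl
  sum-map-+ (x List.∷ xs) = trans (cong (f x + g x +_) (sum-map-+ xs)) ([m+n]+[o+p]≡[m+o]+[n+p] (f x) (g x) _ _)

sum-map-*ˡ : ∀ {A : Set} c (f : A → ℕ) xs → sum (map (λ x → c * f x) xs) ≡ c * sum (map f xs)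
sum-map-*ˡ c f List.[] = sym (*-zeroʳ c)
sum-map-*ˡ c f (x List.∷ xs) = trans (cong (c * f x +_) (sum-map-*ˡ c f xs)) (sym (*-distribˡ-+ c (f x) _))

sum-map-*ʳ : ∀ {A : Set} c (f : A → ℕ) xs → sum (map (λ x → f x * c) xs) ≡ sum (map f xs) * c
sum-map-*ʳ c f xs = trans (sum-map-cong (λ x → *-comm (f x) c) xs) (trans (sum-map-*ˡ c f xs) (*-comm c _))

cubeSum : (k : ℕ) → (Vec Bool k → ℕ) → ℕ
cubeSum k F = sum (map F (cube k))

cubeSum-suc : ∀ k (F : Vec Bool (suc k) → ℕ) →
  cubeSum (suc k) F ≡ cubeSum k (F ∘ (false ∷_)) + cubeSum k (F ∘ (true ∷_))
cubeSum-suc k F = begin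
  sum (map F (map (false ∷_) (cube k) List.++ map (true ∷_) (cube k)))
    ≡⟨ cong sum (map-++ F (map (false ∷_) (cube k)) _) ⟩
  sum (map F (map (false ∷_) (cube k)) List.++ map F (map (true ∷_) (cube k)))
    ≡⟨ sum-++ (map F (map (false ∷_) (cube k))) _ ⟩
  sum (map F (map (false ∷_) (cube k))) + sum (map F (map (true ∷_) (cube k)))
    ≡⟨ cong₂ _+_ (cong sum (map-∘ (cube k))) (cong sum (map-∘ (cube k))) ⟨
  cubeSum k (F ∘ (false ∷_)) + cubeSum k (F ∘ (true ∷_)) ∎
  where open ≡-Reasoning

cubeSum-const : ∀ k c → cubeSum k (λ _ → c) ≡ 2 ^ k * c
cubeSum-const zero c = refl
cubeSum-const (suc k) c = begin
  cubeSum (suc k) (λ _ → c)          ≡⟨ cubeSum-suc k _ ⟩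
  cubeSum k (λ _ → c) + cubeSum k (λ _ → c) ≡⟨ cong₂ _+_ (cubeSum-const k c) (cubeSum-const k c) ⟩
  2 ^ k * c + 2 ^ k * c              ≡⟨ *-distribʳ-+ c (2 ^ k) (2 ^ k) ⟨
  (2 ^ k + 2 ^ k) * c                ≡⟨ cong (λ x → (2 ^ k + x) * c) (+-identityʳ (2 ^ k)) ⟨
  2 ^ suc k * c                      ∎
  where open ≡-Reasoning

cubeSum-++ : ∀ a b (F : Vec Bool (a + b) → ℕ) →
  cubeSum (a + b) F ≡ cubeSum a (λ u → cubeSum b (λ v → F (u ++ v)))
cubeSum-++ zero b F = sym (+-identityʳ _)
cubeSum-++ (suc a) b F = begin
  cubeSum (suc (a + b)) F                                                    ≡⟨ cubeSum-suc (a + b) F ⟩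
  cubeSum (a + b) (F ∘ (false ∷_)) + cubeSum (a + b) (F ∘ (true ∷_))
    ≡⟨ cong₂ _+_ (cubeSum-++ a b (F ∘ (false ∷_))) (cubeSum-++ a b (F ∘ (true ∷_))) ⟩
  cubeSum a (λ u → cubeSum b (λ v → F (false ∷ u ++ v))) + cubeSum a (λ u → cubeSum b (λ v → F (true ∷ u ++ v)))
    ≡⟨ cubeSum-suc a (λ u → cubeSum b (λ v → F (u ++ v))) ⟨
  cubeSum (suc a) (λ u → cubeSum b (λ v → F (u ++ v)))                      ∎
  where open ≡-Reasoning

cubeSum-comm : ∀ a b (G : Vec Bool a → Vec Bool b → ℕ) →
  cubeSum a (λ u → cubeSum b (G u)) ≡ cubeSum b (λ v → cubeSum a (λ u → G u v))
cubeSum-comm zero b G = trans (+-identityʳ _) (sum-map-cong (λ v → sym (+-identityʳ (G [] v))) (cube b))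
cubeSum-comm (suc a) b G = begin
  cubeSum (suc a) (λ u → cubeSum b (G u))     ≡⟨ cubeSum-suc a _ ⟩
  cubeSum a (λ u → cubeSum b (G (false ∷ u))) + cubeSum a (λ u → cubeSum b (G (true ∷ u)))
    ≡⟨ cong₂ _+_ (cubeSum-comm a b (G ∘ (false ∷_))) (cubeSum-comm a b (G ∘ (true ∷_))) ⟩
  cubeSum b (λ v → cubeSum a (λ u → G (false ∷ u) v)) + cubeSum b (λ v → cubeSum a (λ u → G (true ∷ u) v))
    ≡⟨ sum-map-+ (cube b) ⟨
  cubeSum b (λ v → cubeSum a (λ u → G (false ∷ u) v) + cubeSum a (λ u → G (true ∷ u) v))
    ≡⟨ sum-map-cong (λ v → cubeSum-suc a (λ u → G u v)) (cube b) ⟨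
  cubeSum b (λ v → cubeSum (suc a) (λ u → G u v)) ∎
  where open ≡-Reasoning

cubeSum-flipAt : ∀ k (i : Fin k) (F : Vec Bool k → ℕ) → cubeSum k (F ∘ flipAt i) ≡ cubeSum k F
cubeSum-flipAt (suc k) zero F = begin
  cubeSum (suc k) (F ∘ flipAt zero)                  ≡⟨ cubeSum-suc k _ ⟩
  cubeSum k (F ∘ (true ∷_)) + cubeSum k (F ∘ (false ∷_)) ≡⟨ +-comm (cubeSum k (F ∘ (true ∷_))) _ ⟩
  cubeSum k (F ∘ (false ∷_)) + cubeSum k (F ∘ (true ∷_)) ≡⟨ cubeSum-suc k F ⟨
  cubeSum (suc k) F                                  ∎
  where open ≡-Reasoning
cubeSum-flipAt (suc k) (suc i) F = begin
  cubeSum (suc k) (F ∘ flipAt (suc i))               ≡⟨ cubeSum-suc k _ ⟩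
  cubeSum k (λ x → F (false ∷ flipAt i x)) + cubeSum k (λ x → F (true ∷ flipAt i x))
    ≡⟨ cong₂ _+_ (cubeSum-flipAt k i (F ∘ (false ∷_))) (cubeSum-flipAt k i (F ∘ (true ∷_))) ⟩
  cubeSum k (F ∘ (false ∷_)) + cubeSum k (F ∘ (true ∷_)) ≡⟨ cubeSum-suc k F ⟨
  cubeSum (suc k) F                                  ∎
  where open ≡-Reasoning

finSum : (k : ℕ) → (Fin k → ℕ) → ℕ
finSum k a = sum (map a (allFin k))

finSum-suc : ∀ k (a : Fin (suc k) → ℕ) → finSum (suc k) a ≡ a zero + finSum k (a ∘ suc)
finSum-suc k a = cong (λ xs → a zero + sum xs) (trans (map-tabulate suc a) (sym (map-tabulate (λ i → i) (a ∘ suc))))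

finSum-↑ : ∀ a b (g : Fin (a + b) → ℕ) → finSum (a + b) g ≡ finSum a (g ∘ (_↑ˡ b)) + finSum b (g ∘ (a ↑ʳ_))
finSum-↑ zero b g = refl
finSum-↑ (suc a) b g = begin
  finSum (suc (a + b)) g                                      ≡⟨ finSum-suc (a + b) g ⟩
  g zero + finSum (a + b) (g ∘ suc)                           ≡⟨ cong (g zero +_) (finSum-↑ a b (g ∘ suc)) ⟩
  g zero + (finSum a (g ∘ suc ∘ (_↑ˡ b)) + finSum b (g ∘ (suc a ↑ʳ_))) ≡⟨ +-assoc (g zero) _ _ ⟨
  g zero + finSum a (g ∘ suc ∘ (_↑ˡ b)) + finSum b (g ∘ (suc a ↑ʳ_))   ≡⟨ cong (_+ finSum b (g ∘ (suc a ↑ʳ_))) (finSum-suc a (g ∘ (_↑ˡ b))) ⟨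
  finSum (suc a) (g ∘ (_↑ˡ b)) + finSum b (g ∘ (suc a ↑ʳ_))  ∎
  where open ≡-Reasoning

finSum-combine : ∀ n m (g : Fin (n * m) → ℕ) → finSum (n * m) g ≡ finSum n (λ i → finSum m (λ j → g (combine i j)))
finSum-combine zero m g = refl
finSum-combine (suc n) m g = begin
  finSum (m + n * m) g                                            ≡⟨ finSum-↑ m (n * m) g ⟩
  finSum m (g ∘ (_↑ˡ n * m)) + finSum (n * m) (g ∘ (m ↑ʳ_))      ≡⟨ cong (finSum m (g ∘ (_↑ˡ n * m)) +_) (finSum-combine n m (g ∘ (m ↑ʳ_))) ⟩
  finSum m (g ∘ (_↑ˡ n * m)) + finSum n (λ i → finSum m (λ j → g (m ↑ʳ combine i j))) ≡⟨ finSum-suc n _ ⟨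
  finSum (suc n) (λ i → finSum m (λ j → g (combine i j)))        ∎
  where open ≡-Reasoning

-- Influences as counts

influenceCount : ∀ {k} → (Vec Bool k → Bool) → Fin k → ℕ
influenceCount {k} F i = cubeSum k (λ x → bit (F x xor F (flipAt i x)))

influenceCount-cong : ∀ {k} {F G : Vec Bool k → Bool} → (∀ x → F x ≡ G x) → ∀ i →
  influenceCount F i ≡ influenceCount G i
influenceCount-cong {k} F≗G i = sum-map-cong (λ x → cong₂ (λ a b → bit (a xor b)) (F≗G x) (F≗G (flipAt i x))) (cube k)

influenceCount-const : ∀ {k} b (i : Fin k) → influenceCount (λ _ → b) i ≡ 0
influenceCount-const {k} b i = begin
  cubeSum k (λ _ → bit (b xor b)) ≡⟨ sum-map-cong (λ _ → cong bit (xor-same b)) (cube k) ⟩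
  cubeSum k (λ _ → 0)             ≡⟨ cubeSum-const k 0 ⟩
  2 ^ k * 0                       ≡⟨ *-zeroʳ (2 ^ k) ⟩
  0                               ∎
  where open ≡-Reasoning

bit≤1 : ∀ b → bit b ≤ 1
bit≤1 true = ≤-refl
bit≤1 false = z≤n

influenceCount≤2^k : ∀ {k} (F : Vec Bool k → Bool) i → influenceCount F i ≤ 2 ^ k
influenceCount≤2^k {k} F i = begin
  influenceCount F i  ≤⟨ sum-map-mono (λ x → bit≤1 (F x xor F (flipAt i x))) (cube k) ⟩
  cubeSum k (λ _ → 1) ≡⟨ cubeSum-const k 1 ⟩
  2 ^ k * 1           ≡⟨ *-identityʳ (2 ^ k) ⟩
  2 ^ k               ∎
  where open ≤-Reasoning

bit-xor-∘ : ∀ (ψ : Bool → Bool) a b → bit (ψ a xor ψ b) ≡ bit (a xor b) * bit (ψ false xor ψ true)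
bit-xor-∘ ψ false false = cong bit (xor-same (ψ false))
bit-xor-∘ ψ true true = cong bit (xor-same (ψ true))
bit-xor-∘ ψ false true = sym (+-identityʳ _)
bit-xor-∘ ψ true false = trans (cong bit (xor-comm (ψ true) (ψ false))) (sym (+-identityʳ _))

influenceCount-∘ : ∀ {k} (ψ : Bool → Bool) (F : Vec Bool k → Bool) i →
  influenceCount (ψ ∘ F) i ≡ influenceCount F i * bit (ψ false xor ψ true)
influenceCount-∘ {k} ψ F i = trans
  (sum-map-cong (λ x → bit-xor-∘ ψ (F x) (F (flipAt i x))) (cube k))
  (sum-map-*ʳ _ (λ x → bit (F x xor F (flipAt i x))) (cube k))

flipAt-↑ˡ : ∀ {a b} (j : Fin a) (u : Vec Bool a) (v : Vec Bool b) → flipAt (j ↑ˡ b) (u ++ v) ≡ flipAt j u ++ v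
flipAt-↑ˡ zero (x ∷ u) v = refl
flipAt-↑ˡ (suc j) (x ∷ u) v = cong (x ∷_) (flipAt-↑ˡ j u v)

flipAt-↑ʳ : ∀ {a b} (c : Fin b) (u : Vec Bool a) (v : Vec Bool b) → flipAt (a ↑ʳ c) (u ++ v) ≡ u ++ flipAt c v
flipAt-↑ʳ c [] v = refl
flipAt-↑ʳ c (x ∷ u) v = cong (x ∷_) (flipAt-↑ʳ c u v)

influenceCount-↑ˡ : ∀ a b (F : Vec Bool (a + b) → Bool) (j : Fin a) →
  influenceCount F (j ↑ˡ b) ≡ cubeSum b (λ v → influenceCount (λ u → F (u ++ v)) j)
influenceCount-↑ˡ a b F j = begin
  influenceCount F (j ↑ˡ b)
    ≡⟨ cubeSum-++ a b _ ⟩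
  cubeSum a (λ u → cubeSum b (λ v → bit (F (u ++ v) xor F (flipAt (j ↑ˡ b) (u ++ v)))))
    ≡⟨ sum-map-cong (λ u → sum-map-cong (λ v → cong (λ w → bit (F (u ++ v) xor F w)) (flipAt-↑ˡ j u v)) (cube b)) (cube a) ⟩
  cubeSum a (λ u → cubeSum b (λ v → bit (F (u ++ v) xor F (flipAt j u ++ v))))
    ≡⟨ cubeSum-comm a b _ ⟩
  cubeSum b (λ v → influenceCount (λ u → F (u ++ v)) j) ∎
  where open ≡-Reasoning

influenceCount-↑ʳ : ∀ a b (F : Vec Bool (a + b) → Bool) (c : Fin b) →
  influenceCount F (a ↑ʳ c) ≡ cubeSum a (λ u → influenceCount (λ v → F (u ++ v)) c)
influenceCount-↑ʳ a b F c = trans (cubeSum-++ a b _)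
  (sum-map-cong (λ u → sum-map-cong (λ v → cong (λ w → bit (F (u ++ v) xor F w)) (flipAt-↑ʳ c u v)) (cube b)) (cube a))

-- Composition with a block function

ones zeros : ∀ {m} → (Vec Bool m → Bool) → ℕ
ones {m} φ = cubeSum m (bit ∘ φ)
zeros {m} φ = cubeSum m (bit ∘ not ∘ φ)

zeros+ones : ∀ {m} (φ : Vec Bool m → Bool) → zeros φ + ones φ ≡ 2 ^ m
zeros+ones {m} φ = begin
  zeros φ + ones φ                        ≡⟨ sum-map-+ (cube m) ⟨
  cubeSum m (λ u → bit (not (φ u)) + bit (φ u)) ≡⟨ sum-map-cong (λ u → bit-not+bit (φ u)) (cube m) ⟩
  cubeSum m (λ _ → 1)                     ≡⟨ cubeSum-const m 1 ⟩
  2 ^ m * 1                               ≡⟨ *-identityʳ (2 ^ m) ⟩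
  2 ^ m                                   ∎
  where
  open ≡-Reasoning
  bit-not+bit : ∀ b → bit (not b) + bit b ≡ 1
  bit-not+bit true = refl
  bit-not+bit false = refl

cubeSum-∘ : ∀ {m} (φ : Vec Bool m → Bool) (ψ : Bool → ℕ) →
  cubeSum m (ψ ∘ φ) ≡ zeros φ * ψ false + ones φ * ψ true
cubeSum-∘ {m} φ ψ = begin
  cubeSum m (ψ ∘ φ)
    ≡⟨ sum-map-cong (λ u → ψ-by-cases (φ u)) (cube m) ⟩
  cubeSum m (λ u → bit (not (φ u)) * ψ false + bit (φ u) * ψ true)
    ≡⟨ sum-map-+ (cube m) ⟩
  cubeSum m (λ u → bit (not (φ u)) * ψ false) + cubeSum m (λ u → bit (φ u) * ψ true)
    ≡⟨ cong₂ _+_ (sum-map-*ʳ (ψ false) (bit ∘ not ∘ φ) (cube m)) (sum-map-*ʳ (ψ true) (bit ∘ φ) (cube m)) ⟩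
  zeros φ * ψ false + ones φ * ψ true ∎
  where
  open ≡-Reasoning
  ψ-by-cases : ∀ b → ψ b ≡ bit (not b) * ψ false + bit b * ψ true
  ψ-by-cases false = sym (trans (+-identityʳ _) (+-identityʳ _))
  ψ-by-cases true = sym (+-identityʳ _)

-- The number of y ∈ {0,1}^{nm} whose blocks are mapped by φ to z.
fibreSize : ∀ {m n} → (Vec Bool m → Bool) → Vec Bool n → ℕ
fibreSize φ [] = 1
fibreSize φ (b ∷ z) = (if b then ones φ else zeros φ) * fibreSize φ z

weightedSum : ∀ {m} (φ : Vec Bool m → Bool) n → (Vec Bool n → ℕ) → ℕ
weightedSum φ n Φ = cubeSum n (λ z → Φ z * fibreSize φ z)

weightedSum-cong : ∀ {m} (φ : Vec Bool m → Bool) n {Φ Ψ : Vec Bool n → ℕ} → (∀ z → Φ z ≡ Ψ z) →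
  weightedSum φ n Φ ≡ weightedSum φ n Ψ
weightedSum-cong φ n Φ≗Ψ = sum-map-cong (λ z → cong (_* fibreSize φ z) (Φ≗Ψ z)) (cube n)

weightedSum-suc : ∀ {m} (φ : Vec Bool m → Bool) n (Φ : Vec Bool (suc n) → ℕ) →
  weightedSum φ (suc n) Φ ≡ zeros φ * weightedSum φ n (Φ ∘ (false ∷_)) + ones φ * weightedSum φ n (Φ ∘ (true ∷_))
weightedSum-suc φ n Φ = trans (cubeSum-suc n _) (cong₂ _+_ (pull (zeros φ) false) (pull (ones φ) true))
  where
  pull : ∀ c b → cubeSum n (λ z → Φ (b ∷ z) * (c * fibreSize φ z)) ≡ c * weightedSum φ n (Φ ∘ (b ∷_))
  pull c b = trans (sum-map-cong (λ z → m*[n*o]≡n*[m*o] (Φ (b ∷ z)) c (fibreSize φ z)) (cube n))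
                   (sum-map-*ˡ c (λ z → Φ (b ∷ z) * fibreSize φ z) (cube n))

take-++ : ∀ {A : Set} {a b} (u : Vec A a) (v : Vec A b) → take a (u ++ v) ≡ u
take-++ [] v = refl
take-++ (x ∷ u) v = cong (x ∷_) (take-++ u v)

drop-++ : ∀ {A : Set} {a b} (u : Vec A a) (v : Vec A b) → drop a (u ++ v) ≡ v
drop-++ [] v = refl
drop-++ (x ∷ u) v = drop-++ u v

blocks-++ : ∀ n m (u : Vec Bool m) (v : Vec Bool (n * m)) → blocks (suc n) m (u ++ v) ≡ u ∷ blocks n m v
blocks-++ n m u v = cong₂ (λ w y → w ∷ blocks n m y) (take-++ u v) (drop-++ u v)

-- Red with an arbitrary block function φ in place of h: Red m t n f is composeBlocks (h m t) n f.
composeBlocks : ∀ {m} (φ : Vec Bool m → Bool) n → (Vec Bool n → Bool) → Vec Bool (n * m) → Bool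
composeBlocks {m} φ n f y = f (Vec.map φ (blocks n m y))

composeBlocks-++ : ∀ {m} (φ : Vec Bool m → Bool) n (f : Vec Bool (suc n) → Bool) u v →
  composeBlocks φ (suc n) f (u ++ v) ≡ composeBlocks φ n (f ∘ (φ u ∷_)) v
composeBlocks-++ {m} φ n f u v = cong (f ∘ Vec.map φ) (blocks-++ n m u v)

cubeSum-blocks : ∀ {m} (φ : Vec Bool m → Bool) n (Φ : Vec Bool n → ℕ) →
  cubeSum (n * m) (λ y → Φ (Vec.map φ (blocks n m y))) ≡ weightedSum φ n Φ
cubeSum-blocks φ zero Φ = cong (_+ 0) (sym (*-identityʳ (Φ [])))
cubeSum-blocks {m} φ (suc n) Φ = begin
  cubeSum (m + n * m) (λ y → Φ (Vec.map φ (blocks (suc n) m y)))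
    ≡⟨ cubeSum-++ m (n * m) _ ⟩
  cubeSum m (λ u → cubeSum (n * m) (λ v → Φ (Vec.map φ (blocks (suc n) m (u ++ v)))))
    ≡⟨ sum-map-cong (λ u → sum-map-cong (λ v → cong (Φ ∘ Vec.map φ) (blocks-++ n m u v)) (cube (n * m))) (cube m) ⟩
  cubeSum m (λ u → cubeSum (n * m) (λ v → Φ (φ u ∷ Vec.map φ (blocks n m v))))
    ≡⟨ sum-map-cong (λ u → cubeSum-blocks φ n (Φ ∘ (φ u ∷_))) (cube m) ⟩
  cubeSum m (λ u → weightedSum φ n (Φ ∘ (φ u ∷_)))
    ≡⟨ cubeSum-∘ φ (λ b → weightedSum φ n (Φ ∘ (b ∷_))) ⟩
  zeros φ * weightedSum φ n (Φ ∘ (false ∷_)) + ones φ * weightedSum φ n (Φ ∘ (true ∷_))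
    ≡⟨ weightedSum-suc φ n Φ ⟨
  weightedSum φ (suc n) Φ ∎
  where open ≡-Reasoning

-- 2^{nm} times the influence of coordinate i on f under μ_p with p = ones φ / 2^m.
biasedInfluenceCount : ∀ {m n} (φ : Vec Bool m → Bool) → (Vec Bool n → Bool) → Fin n → ℕ
biasedInfluenceCount {n = n} φ f i = weightedSum φ n (λ z → bit (f z xor f (flipAt i z)))

biasedInfluenceCount-zero : ∀ {m n} (φ : Vec Bool m → Bool) (f : Vec Bool (suc n) → Bool) →
  biasedInfluenceCount φ f zero ≡ 2 ^ m * weightedSum φ n (λ z → bit (f (false ∷ z) xor f (true ∷ z)))
biasedInfluenceCount-zero {m} {n} φ f = begin
  biasedInfluenceCount φ f zero
    ≡⟨ weightedSum-suc φ n (λ z → bit (f z xor f (flipAt zero z))) ⟩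
  zeros φ * D + ones φ * weightedSum φ n (λ z → bit (f (true ∷ z) xor f (false ∷ z)))
    ≡⟨ cong (λ w → zeros φ * D + ones φ * w) (weightedSum-cong φ n (λ z → cong bit (xor-comm (f (true ∷ z)) _))) ⟩
  zeros φ * D + ones φ * D
    ≡⟨ *-distribʳ-+ D (zeros φ) (ones φ) ⟨
  (zeros φ + ones φ) * D
    ≡⟨ cong (_* D) (zeros+ones φ) ⟩
  2 ^ m * D ∎
  where
  open ≡-Reasoning
  D = weightedSum φ n (λ z → bit (f (false ∷ z) xor f (true ∷ z)))

m*[n*o+p*q]≡n*[m*o]+p*[m*q] : ∀ a x y p q → a * (x * p + y * q) ≡ x * (a * p) + y * (a * q)
m*[n*o+p*q]≡n*[m*o]+p*[m*q] a x y p q = trans (*-distribˡ-+ a (x * p) (y * q))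
  (cong₂ _+_ (m*[n*o]≡n*[m*o] a x p) (m*[n*o]≡n*[m*o] a y q))

influenceCount-composeBlocks : ∀ {m} (φ : Vec Bool m → Bool) n (f : Vec Bool n → Bool) i j →
  2 ^ m * influenceCount (composeBlocks φ n f) (combine i j) ≡ influenceCount φ j * biasedInfluenceCount φ f i
influenceCount-composeBlocks {m} φ (suc n) f zero j = begin
  2 ^ m * influenceCount (composeBlocks φ (suc n) f) (j ↑ˡ n * m)
    ≡⟨ cong (2 ^ m *_) (influenceCount-↑ˡ m (n * m) (composeBlocks φ (suc n) f) j) ⟩
  2 ^ m * cubeSum (n * m) (λ v → influenceCount (λ u → composeBlocks φ (suc n) f (u ++ v)) j)
    ≡⟨ cong (2 ^ m *_) (sum-map-cong (λ v → trans
         (influenceCount-cong (λ u → composeBlocks-++ φ n f u v) j)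
         (influenceCount-∘ (λ b → f (b ∷ B v)) φ j)) (cube (n * m))) ⟩
  2 ^ m * cubeSum (n * m) (λ v → influenceCount φ j * D (B v))
    ≡⟨ cong (2 ^ m *_) (sum-map-*ˡ (influenceCount φ j) (D ∘ B) (cube (n * m))) ⟩
  2 ^ m * (influenceCount φ j * cubeSum (n * m) (D ∘ B))
    ≡⟨ cong (λ w → 2 ^ m * (influenceCount φ j * w)) (cubeSum-blocks φ n D) ⟩
  2 ^ m * (influenceCount φ j * weightedSum φ n D)
    ≡⟨ m*[n*o]≡n*[m*o] (2 ^ m) (influenceCount φ j) _ ⟩
  influenceCount φ j * (2 ^ m * weightedSum φ n D)
    ≡⟨ cong (influenceCount φ j *_) (biasedInfluenceCount-zero φ f) ⟨
  influenceCount φ j * biasedInfluenceCount φ f zero ∎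
  where
  open ≡-Reasoning
  B : Vec Bool (n * m) → Vec Bool n
  B v = Vec.map φ (blocks n m v)
  D : Vec Bool n → ℕ
  D z = bit (f (false ∷ z) xor f (true ∷ z))
influenceCount-composeBlocks {m} φ (suc n) f (suc i) j = begin
  2 ^ m * influenceCount (composeBlocks φ (suc n) f) (m ↑ʳ combine i j)
    ≡⟨ cong (2 ^ m *_) (influenceCount-↑ʳ m (n * m) (composeBlocks φ (suc n) f) (combine i j)) ⟩
  2 ^ m * cubeSum m (λ u → influenceCount (λ v → composeBlocks φ (suc n) f (u ++ v)) (combine i j))
    ≡⟨ cong (2 ^ m *_) (sum-map-cong (λ u → influenceCount-cong (composeBlocks-++ φ n f u) (combine i j)) (cube m)) ⟩
  2 ^ m * cubeSum m (Ψ ∘ φ)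
    ≡⟨ cong (2 ^ m *_) (cubeSum-∘ φ Ψ) ⟩
  2 ^ m * (zeros φ * Ψ false + ones φ * Ψ true)
    ≡⟨ m*[n*o+p*q]≡n*[m*o]+p*[m*q] (2 ^ m) (zeros φ) (ones φ) (Ψ false) (Ψ true) ⟩
  zeros φ * (2 ^ m * Ψ false) + ones φ * (2 ^ m * Ψ true)
    ≡⟨ cong₂ (λ a b → zeros φ * a + ones φ * b)
         (influenceCount-composeBlocks φ n (f ∘ (false ∷_)) i j) (influenceCount-composeBlocks φ n (f ∘ (true ∷_)) i j) ⟩
  zeros φ * (d * biasedInfluenceCount φ (f ∘ (false ∷_)) i) + ones φ * (d * biasedInfluenceCount φ (f ∘ (true ∷_)) i)
    ≡⟨ m*[n*o+p*q]≡n*[m*o]+p*[m*q] d (zeros φ) (ones φ) _ _ ⟨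
  d * (zeros φ * biasedInfluenceCount φ (f ∘ (false ∷_)) i + ones φ * biasedInfluenceCount φ (f ∘ (true ∷_)) i)
    ≡⟨ cong (d *_) (weightedSum-suc φ n (λ z → bit (f z xor f (flipAt (suc i) z)))) ⟨
  d * biasedInfluenceCount φ f (suc i) ∎
  where
  open ≡-Reasoning
  d = influenceCount φ j
  Ψ : Bool → ℕ
  Ψ b = influenceCount (composeBlocks φ n (f ∘ (b ∷_))) (combine i j)

-- The threshold function h

bit-xor≤ : ∀ a b → bit (a xor b) ≤ bit a + bit b
bit-xor≤ true true = z≤n
bit-xor≤ true false = ≤-refl
bit-xor≤ false true = ≤-refl
bit-xor≤ false false = z≤n

influenceCount≤2*ones : ∀ {m} (φ : Vec Bool m → Bool) j → influenceCount φ j ≤ 2 * ones φ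
influenceCount≤2*ones {m} φ j = begin
  influenceCount φ j                                  ≤⟨ sum-map-mono (λ u → bit-xor≤ (φ u) (φ (flipAt j u))) (cube m) ⟩
  cubeSum m (λ u → bit (φ u) + bit (φ (flipAt j u))) ≡⟨ sum-map-+ (cube m) ⟩
  ones φ + cubeSum m (bit ∘ φ ∘ flipAt j)             ≡⟨ cong (ones φ +_) (cubeSum-flipAt m j (bit ∘ φ)) ⟩
  ones φ + ones φ                                     ≡⟨ cong (ones φ +_) (+-identityʳ (ones φ)) ⟨
  2 * ones φ                                          ∎
  where open ≤-Reasoning

threshold : ∀ {m} → ℕ → Vec Bool m → Bool
threshold T u = T ≤ᵇ Bin u

≤ᵇ-+ : ∀ T P x → (T ≤ᵇ P + x) ≡ (T ∸ P ≤ᵇ x)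
≤ᵇ-+ T zero x = refl
≤ᵇ-+ zero (suc P) x = refl
≤ᵇ-+ (suc T) (suc P) x = trans (suc≤ᵇsuc T (P + x)) (≤ᵇ-+ T P x)
  where
  suc≤ᵇsuc : ∀ a b → (suc a ≤ᵇ suc b) ≡ (a ≤ᵇ b)
  suc≤ᵇsuc zero b = refl
  suc≤ᵇsuc (suc a) b = refl

≤ᵇ-false : ∀ {a b} → b < a → (a ≤ᵇ b) ≡ false
≤ᵇ-false {a} {b} b<a with a ≤ᵇ b in eq
... | false = refl
... | true = contradiction (≤ᵇ⇒≤ a b (subst T (sym eq) _)) (<⇒≱ b<a)

Bin<2^m : ∀ {m} (u : Vec Bool m) → Bin u < 2 ^ m
Bin<2^m [] = s≤s z≤n
Bin<2^m {suc m} (b ∷ u) = begin-strict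
  bit b * 2 ^ m + Bin u  <⟨ +-monoʳ-< (bit b * 2 ^ m) (Bin<2^m u) ⟩
  bit b * 2 ^ m + 2 ^ m  ≤⟨ +-monoˡ-≤ (2 ^ m) (*-monoˡ-≤ (2 ^ m) (bit≤1 b)) ⟩
  1 * 2 ^ m + 2 ^ m      ≡⟨ cong (_+ 2 ^ m) (*-identityˡ (2 ^ m)) ⟩
  2 ^ m + 2 ^ m          ≡⟨ cong (2 ^ m +_) (+-identityʳ (2 ^ m)) ⟨
  2 ^ suc m              ∎
  where open ≤-Reasoning

threshold-true∷ : ∀ {m} T (u : Vec Bool m) → threshold T (true ∷ u) ≡ threshold (T ∸ 2 ^ m) u
threshold-true∷ {m} T u = trans (cong (λ P → T ≤ᵇ P + Bin u) (*-identityˡ (2 ^ m))) (≤ᵇ-+ T (2 ^ m) (Bin u))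

threshold-≥2^m : ∀ {m T} → 2 ^ m ≤ T → (u : Vec Bool m) → threshold T u ≡ false
threshold-≥2^m 2^m≤T u = ≤ᵇ-false (<-≤-trans (Bin<2^m u) 2^m≤T)

ones-threshold : ∀ m T → ones (threshold {m} T) ≡ 2 ^ m ∸ T
ones-threshold zero zero = refl
ones-threshold zero (suc T) = sym (0∸n≡0 T)
ones-threshold (suc m) T = begin
  ones (threshold {suc m} T)                                     ≡⟨ cubeSum-suc m _ ⟩
  ones (threshold {m} T) + cubeSum m (bit ∘ threshold T ∘ (true ∷_))
    ≡⟨ cong (ones (threshold {m} T) +_) (sum-map-cong (cong bit ∘ threshold-true∷ T) (cube m)) ⟩
  ones (threshold {m} T) + ones (threshold {m} (T ∸ 2 ^ m))      ≡⟨ cong₂ _+_ (ones-threshold m T) (ones-threshold m (T ∸ 2 ^ m)) ⟩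
  (2 ^ m ∸ T) + (2 ^ m ∸ (T ∸ 2 ^ m))                            ≡⟨ halves (2 ^ m) T ⟩
  (2 ^ m + 2 ^ m) ∸ T                                            ≡⟨ cong (λ x → (2 ^ m + x) ∸ T) (+-identityʳ (2 ^ m)) ⟨
  2 ^ suc m ∸ T                                                  ∎
  where
  open ≡-Reasoning
  halves : ∀ P T → (P ∸ T) + (P ∸ (T ∸ P)) ≡ (P + P) ∸ T
  halves P T with T ≤? P
  ... | yes T≤P = trans (cong (λ x → (P ∸ T) + (P ∸ x)) (m≤n⇒m∸n≡0 T≤P)) (sym (+-∸-comm P T≤P))
  ... | no T≰P = begin
    (P ∸ T) + (P ∸ (T ∸ P))  ≡⟨ cong (_+ (P ∸ (T ∸ P))) (m≤n⇒m∸n≡0 (<⇒≤ (≰⇒> T≰P))) ⟩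
    P ∸ (T ∸ P)              ≡⟨ cong (_∸ (T ∸ P)) (m+n∸m≡n P P) ⟨
    (P + P ∸ P) ∸ (T ∸ P)    ≡⟨ ∸-+-assoc (P + P) P (T ∸ P) ⟩
    (P + P) ∸ (P + (T ∸ P))  ≡⟨ cong ((P + P) ∸_) (m+[n∸m]≡n (<⇒≤ (≰⇒> T≰P))) ⟩
    (P + P) ∸ T              ∎

-- Fixing the leading bit makes the threshold constant on one of the two halves of the cube,
-- so each bit before j halves the number of points sensitive to bit j.
influenceCount-threshold : ∀ m T (j : Fin m) → influenceCount (threshold {m} T) j ≤ 2 ^ (m ∸ toℕ j)
influenceCount-threshold (suc m) T zero = influenceCount≤2^k (threshold {suc m} T) zero
influenceCount-threshold (suc m) T (suc j) = begin
  influenceCount (threshold {suc m} T) (suc j)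
    ≡⟨ cubeSum-suc m _ ⟩
  influenceCount (threshold {m} T) j + influenceCount (threshold T ∘ (true ∷_)) j
    ≡⟨ cong (influenceCount (threshold {m} T) j +_) (influenceCount-cong (threshold-true∷ T) j) ⟩
  influenceCount (threshold {m} T) j + influenceCount (threshold {m} (T ∸ 2 ^ m)) j
    ≤⟨ one-half-constant (T ≤? 2 ^ m) ⟩
  2 ^ (m ∸ toℕ j) ∎
  where
  open ≤-Reasoning
  one-half-constant : Dec (T ≤ 2 ^ m) →
    influenceCount (threshold {m} T) j + influenceCount (threshold {m} (T ∸ 2 ^ m)) j ≤ 2 ^ (m ∸ toℕ j)
  one-half-constant (yes T≤2^m) = begin
    influenceCount (threshold {m} T) j + influenceCount (threshold {m} (T ∸ 2 ^ m)) j
      ≡⟨ cong (λ T′ → influenceCount (threshold {m} T) j + influenceCount (threshold {m} T′) j) (m≤n⇒m∸n≡0 T≤2^m) ⟩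
    influenceCount (threshold {m} T) j + influenceCount (λ _ → true) j
      ≡⟨ cong (influenceCount (threshold {m} T) j +_) (influenceCount-const true j) ⟩
    influenceCount (threshold {m} T) j + 0
      ≤⟨ ≤-reflexive (+-identityʳ _) ⟩
    influenceCount (threshold {m} T) j
      ≤⟨ influenceCount-threshold m T j ⟩
    2 ^ (m ∸ toℕ j) ∎
  one-half-constant (no T≰2^m) = begin
    influenceCount (threshold {m} T) j + influenceCount (threshold {m} (T ∸ 2 ^ m)) j
      ≡⟨ cong (_+ influenceCount (threshold {m} (T ∸ 2 ^ m)) j)
           (trans (influenceCount-cong (threshold-≥2^m (<⇒≤ (≰⇒> T≰2^m))) j) (influenceCount-const false j)) ⟩
    influenceCount (threshold {m} (T ∸ 2 ^ m)) j
      ≤⟨ influenceCount-threshold m (T ∸ 2 ^ m) j ⟩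
    2 ^ (m ∸ toℕ j) ∎

ones-h : ∀ m t → t ≤ 2 ^ m → ones (h m t) ≡ t
ones-h m t t≤2^m = trans (ones-threshold m (2 ^ m ∸ t)) (m∸[m∸n]≡n t≤2^m)

zeros-h : ∀ m t → t ≤ 2 ^ m → zeros (h m t) ≡ 2 ^ m ∸ t
zeros-h m t t≤2^m = begin
  zeros (h m t)                      ≡⟨ m+n∸n≡m (zeros (h m t)) t ⟨
  zeros (h m t) + t ∸ t              ≡⟨ cong (λ x → zeros (h m t) + x ∸ t) (ones-h m t t≤2^m) ⟨
  zeros (h m t) + ones (h m t) ∸ t   ≡⟨ cong (_∸ t) (zeros+ones (h m t)) ⟩
  2 ^ m ∸ t                          ∎
  where open ≡-Reasoning

influenceCount-h : ∀ m t → t ≤ 2 ^ m → (j : Fin m) → influenceCount (h m t) j ≤ 2 * (t ⊓ 2 ^ (m ∸ suc (toℕ j)))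
influenceCount-h m t t≤2^m j = begin
  influenceCount (h m t) j                     ≤⟨ ⊓-glb ≤2t ≤2^[m∸j] ⟩
  (2 * t) ⊓ (2 * 2 ^ (m ∸ suc (toℕ j)))        ≡⟨ *-distribˡ-⊓ 2 t _ ⟨
  2 * (t ⊓ 2 ^ (m ∸ suc (toℕ j)))              ∎
  where
  open ≤-Reasoning
  ≤2t : influenceCount (h m t) j ≤ 2 * t
  ≤2t = subst (λ x → influenceCount (h m t) j ≤ 2 * x) (ones-h m t t≤2^m) (influenceCount≤2*ones (h m t) j)
  ≤2^[m∸j] : influenceCount (h m t) j ≤ 2 * 2 ^ (m ∸ suc (toℕ j))
  ≤2^[m∸j] = subst (λ e → influenceCount (h m t) j ≤ 2 ^ e) (+-∸-assoc 1 (toℕ<n j)) (influenceCount-threshold m (2 ^ m ∸ t) j)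

-- The logarithmic bound

finSum-4^ : ∀ m → 3 * finSum m (λ j → 2 ^ (m ∸ suc (toℕ j)) * 2 ^ (m ∸ suc (toℕ j))) + 1 ≡ 2 ^ m * 2 ^ m
finSum-4^ zero = refl
finSum-4^ (suc m) = begin
  3 * finSum (suc m) (λ j → 2 ^ (suc m ∸ suc (toℕ j)) * 2 ^ (suc m ∸ suc (toℕ j))) + 1
    ≡⟨ cong (λ s → 3 * s + 1) (finSum-suc m (λ j → 2 ^ (suc m ∸ suc (toℕ j)) * 2 ^ (suc m ∸ suc (toℕ j)))) ⟩
  3 * (x * x + S) + 1   ≡⟨ [p*q]*[r*s]≡[p*r]*[q*s] (x * x) S ⟩
  3 * (x * x) + (3 * S + 1) ≡⟨ cong (3 * (x * x) +_) (finSum-4^ m) ⟩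
  3 * (x * x) + x * x   ≡⟨ four-squares x ⟩
  (2 * x) * (2 * x)     ∎
  where
  open ≡-Reasoning
  x = 2 ^ m
  S = finSum m (λ j → 2 ^ (m ∸ suc (toℕ j)) * 2 ^ (m ∸ suc (toℕ j)))
  [p*q]*[r*s]≡[p*r]*[q*s] : ∀ a s → 3 * (a + s) + 1 ≡ 3 * a + (3 * s + 1)
  [p*q]*[r*s]≡[p*r]*[q*s] = solve-∀
  four-squares : ∀ x → 3 * (x * x) + x * x ≡ (2 * x) * (2 * x)
  four-squares = solve-∀

2*[m/n]≤[2*m]/n : ∀ m n .{{_ : NonZero n}} → 2 * (m / n) ≤ (2 * m) / n
2*[m/n]≤[2*m]/n m n = begin
  2 * (m / n)            ≡⟨ m*n/n≡m (2 * (m / n)) n ⟨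
  (2 * (m / n) * n) / n  ≤⟨ /-monoˡ-≤ n (≤-trans (≤-reflexive (*-assoc 2 (m / n) n)) (*-monoʳ-≤ 2 (m/n*n≤m m n))) ⟩
  (2 * m) / n            ∎
  where open ≤-Reasoning

⌊log₂[2^m/t]⌋-suc : ∀ m t .{{_ : NonZero t}} → t ≤ 2 ^ m → 1 + ⌊log₂ (2 ^ m / t) ⌋ ≤ ⌊log₂ (2 ^ suc m / t) ⌋
⌊log₂[2^m/t]⌋-suc m t t≤2^m = begin
  1 + ⌊log₂ (2 ^ m / t) ⌋   ≡⟨ ⌊log₂[2*b]⌋≡1+⌊log₂b⌋ (2 ^ m / t) ⟨
  ⌊log₂ (2 * (2 ^ m / t)) ⌋ ≤⟨ ⌊log₂⌋-mono-≤ (2*[m/n]≤[2*m]/n (2 ^ m) t) ⟩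
  ⌊log₂ (2 ^ suc m / t) ⌋   ∎
  where
  open ≤-Reasoning
  instance
    2^m/t≢0 : NonZero (2 ^ m / t)
    2^m/t≢0 = >-nonZero (m≥n⇒m/n>0 t≤2^m)

1≤⌊log₂[2^m/t]⌋ : ∀ m t .{{_ : NonZero t}} → 2 * t ≤ 2 ^ m → 1 ≤ ⌊log₂ (2 ^ m / t) ⌋
1≤⌊log₂[2^m/t]⌋ m t 2t≤2^m = begin
  1                        ≡⟨ ⌊log₂[2^n]⌋≡n 1 ⟨
  ⌊log₂ 2 ⌋                ≡⟨ cong ⌊log₂_⌋ (m*n/n≡m 2 t) ⟨
  ⌊log₂ (2 * t / t) ⌋      ≤⟨ ⌊log₂⌋-mono-≤ (/-monoˡ-≤ t 2t≤2^m) ⟩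
  ⌊log₂ (2 ^ m / t) ⌋      ∎
  where open ≤-Reasoning

-- The terms with 2^(m-1-j) ≥ t equal t², and there are at most ⌊log₂(2^m/t)⌋ of them;
-- the remaining terms are bounded by a geometric series of sum < (2t)²/3.
finSum-min² : ∀ m t .{{_ : NonZero t}} → 2 * t ≤ 2 ^ m →
  finSum m (λ j → (t ⊓ 2 ^ (m ∸ suc (toℕ j))) * (t ⊓ 2 ^ (m ∸ suc (toℕ j)))) ≤ 3 * (t * t) * ⌊log₂ (2 ^ m / t) ⌋
finSum-min² zero t 2t≤1 = contradiction {A = 2 ≤ 1} (≤-trans (*-monoʳ-≤ 2 (>-nonZero⁻¹ t)) 2t≤1) λ { (s≤s ()) }
finSum-min² (suc m) t 2t≤2^[1+m] with 2 * t ≤? 2 ^ m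
... | yes 2t≤2^m = begin
  finSum (suc m) (λ j → c (suc m) j * c (suc m) j) ≡⟨ finSum-suc m (λ j → c (suc m) j * c (suc m) j) ⟩
  (t ⊓ 2 ^ m) * (t ⊓ 2 ^ m) + finSum m (λ j → c m j * c m j)
    ≡⟨ cong (λ x → x * x + finSum m (λ j → c m j * c m j)) (m≤n⇒m⊓n≡m t≤2^m) ⟩
  t * t + finSum m (λ j → c m j * c m j)    ≤⟨ +-mono-≤ (m≤n*m (t * t) 3) (finSum-min² m t 2t≤2^m) ⟩
  3 * (t * t) + 3 * (t * t) * L             ≡⟨ *-suc (3 * (t * t)) L ⟨
  3 * (t * t) * (1 + L)                     ≤⟨ *-monoʳ-≤ (3 * (t * t)) (⌊log₂[2^m/t]⌋-suc m t t≤2^m) ⟩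
  3 * (t * t) * ⌊log₂ (2 ^ suc m / t) ⌋     ∎
  where
  open ≤-Reasoning
  c : ∀ k → Fin k → ℕ
  c k j = t ⊓ 2 ^ (k ∸ suc (toℕ j))
  L = ⌊log₂ (2 ^ m / t) ⌋
  t≤2^m : t ≤ 2 ^ m
  t≤2^m = ≤-trans (m≤n*m t 2) 2t≤2^m
... | no 2t≰2^m = begin
  finSum (suc m) (λ j → c (suc m) j * c (suc m) j) ≡⟨ finSum-suc m (λ j → c (suc m) j * c (suc m) j) ⟩
  (t ⊓ 2 ^ m) * (t ⊓ 2 ^ m) + finSum m (λ j → c m j * c m j)
    ≤⟨ +-mono-≤ (*-mono-≤ (m⊓n≤m t (2 ^ m)) (m⊓n≤m t (2 ^ m))) geometric-tail ⟩
  t * t + 2 * (t * t)                       ≡⟨ three t ⟩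
  3 * (t * t) * 1                           ≤⟨ *-monoʳ-≤ (3 * (t * t)) (1≤⌊log₂[2^m/t]⌋ (suc m) t 2t≤2^[1+m]) ⟩
  3 * (t * t) * ⌊log₂ (2 ^ suc m / t) ⌋     ∎
  where
  open ≤-Reasoning
  c : ∀ k → Fin k → ℕ
  c k j = t ⊓ 2 ^ (k ∸ suc (toℕ j))
  three : ∀ t → t * t + 2 * (t * t) ≡ 3 * (t * t) * 1
  three = solve-∀
  six : ∀ t → (2 * t) * (2 * t) + 2 * (t * t) ≡ 3 * (2 * (t * t))
  six = solve-∀
  G = finSum m (λ j → 2 ^ (m ∸ suc (toℕ j)) * 2 ^ (m ∸ suc (toℕ j)))
  3G<6t² : 3 * G + 1 ≤ 3 * (2 * (t * t))
  3G<6t² = begin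
    3 * G + 1                      ≡⟨ finSum-4^ m ⟩
    2 ^ m * 2 ^ m                  ≤⟨ *-mono-≤ (<⇒≤ (≰⇒> 2t≰2^m)) (<⇒≤ (≰⇒> 2t≰2^m)) ⟩
    (2 * t) * (2 * t)              ≤⟨ m≤m+n _ (2 * (t * t)) ⟩
    (2 * t) * (2 * t) + 2 * (t * t) ≡⟨ six t ⟩
    3 * (2 * (t * t))              ∎
  geometric-tail : finSum m (λ j → c m j * c m j) ≤ 2 * (t * t)
  geometric-tail = ≤-trans
    (sum-map-mono (λ j → *-mono-≤ (m⊓n≤n t _) (m⊓n≤n t _)) (allFin m))
    (*-cancelˡ-≤ 3 (≤-trans (m≤m+n (3 * G) 1) 3G<6t²))

finSum-influenceCount-h² : ∀ m t .{{_ : NonZero t}} → 2 * t ≤ 2 ^ m →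
  finSum m (λ j → influenceCount (h m t) j * influenceCount (h m t) j) ≤ 12 * (t * t) * ⌊log₂ (2 ^ m / t) ⌋
finSum-influenceCount-h² m t 2t≤2^m = begin
  finSum m (λ j → influenceCount (h m t) j * influenceCount (h m t) j)
    ≤⟨ sum-map-mono (λ j → *-mono-≤ (influenceCount-h m t t≤2^m j) (influenceCount-h m t t≤2^m j)) (allFin m) ⟩
  finSum m (λ j → (2 * c j) * (2 * c j))   ≡⟨ sum-map-cong (λ j → [m*n]*[o*p]≡[m*o]*[n*p] 2 (c j) 2 (c j)) (allFin m) ⟩
  finSum m (λ j → 4 * (c j * c j))         ≡⟨ sum-map-*ˡ 4 (λ j → c j * c j) (allFin m) ⟩
  4 * finSum m (λ j → c j * c j)           ≤⟨ *-monoʳ-≤ 4 (finSum-min² m t 2t≤2^m) ⟩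
  4 * (3 * (t * t) * L)                    ≡⟨ twelve (t * t) L ⟩
  12 * (t * t) * L                         ∎
  where
  open ≤-Reasoning
  c : Fin m → ℕ
  c j = t ⊓ 2 ^ (m ∸ suc (toℕ j))
  L = ⌊log₂ (2 ^ m / t) ⌋
  t≤2^m : t ≤ 2 ^ m
  t≤2^m = ≤-trans (m≤n*m t 2) 2t≤2^m
  twelve : ∀ x l → 4 * (3 * x * l) ≡ 12 * x * l
  twelve = solve-∀

finSum-influenceCount-Red² : ∀ m t n (f : Vec Bool n → Bool) .{{_ : NonZero t}} → 2 * t ≤ 2 ^ m →
  (2 ^ m * 2 ^ m) * finSum (n * m) (λ c → influenceCount (Red m t n f) c * influenceCount (Red m t n f) c)
    ≤ 12 * (t * t) * ⌊log₂ (2 ^ m / t) ⌋ * finSum n (λ i → biasedInfluenceCount (h m t) f i * biasedInfluenceCount (h m t) f i)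
finSum-influenceCount-Red² m t n f 2t≤2^m = begin
  (2 ^ m * 2 ^ m) * finSum (n * m) (λ c → I c * I c)
    ≡⟨ sum-map-*ˡ (2 ^ m * 2 ^ m) (λ c → I c * I c) (allFin (n * m)) ⟨
  finSum (n * m) (λ c → (2 ^ m * 2 ^ m) * (I c * I c))
    ≡⟨ sum-map-cong (λ c → [m*n]*[o*p]≡[m*o]*[n*p] (2 ^ m) (2 ^ m) (I c) (I c)) (allFin (n * m)) ⟩
  finSum (n * m) (λ c → (2 ^ m * I c) * (2 ^ m * I c))
    ≡⟨ finSum-combine n m _ ⟩
  finSum n (λ i → finSum m (λ j → (2 ^ m * I (combine i j)) * (2 ^ m * I (combine i j))))
    ≡⟨ sum-map-cong (λ i → sum-map-cong (λ j → cong (λ x → x * x) (influenceCount-composeBlocks (h m t) n f i j)) (allFin m)) (allFin n) ⟩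
  finSum n (λ i → finSum m (λ j → (d j * B i) * (d j * B i)))
    ≡⟨ sum-map-cong (λ i → sum-map-cong (λ j → [m*n]*[o*p]≡[m*o]*[n*p] (d j) (B i) (d j) (B i)) (allFin m)) (allFin n) ⟩
  finSum n (λ i → finSum m (λ j → (d j * d j) * (B i * B i)))
    ≡⟨ sum-map-cong (λ i → sum-map-*ʳ (B i * B i) (λ j → d j * d j) (allFin m)) (allFin n) ⟩
  finSum n (λ i → finSum m (λ j → d j * d j) * (B i * B i))
    ≤⟨ sum-map-mono (λ i → *-monoˡ-≤ (B i * B i) (finSum-influenceCount-h² m t 2t≤2^m)) (allFin n) ⟩
  finSum n (λ i → 12 * (t * t) * ⌊log₂ (2 ^ m / t) ⌋ * (B i * B i))
    ≡⟨ sum-map-*ˡ (12 * (t * t) * ⌊log₂ (2 ^ m / t) ⌋) (λ i → B i * B i) (allFin n) ⟩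
  12 * (t * t) * ⌊log₂ (2 ^ m / t) ⌋ * finSum n (λ i → B i * B i) ∎
  where
  open ≤-Reasoning
  I = influenceCount (Red m t n f)
  d = influenceCount (h m t)
  B = biasedInfluenceCount (h m t) f

-- Passing to probabilities in ℚ

-- Opened only here: with the integer constructor +_ in scope, the ℕ sections (x +_) above do not parse.
open import Data.Integer using (+_; -[1+_])

fromℕ : ℕ → ℚ
fromℕ k = + k ℚ./ 1

fromℕ≡mkℚ : ∀ k → fromℕ k ≡ mkℚ (+ k) 0 (Coprime.sym (Coprime.1-coprimeTo k))
fromℕ≡mkℚ k = ℚ.normalize-coprime (Coprime.sym (Coprime.1-coprimeTo k))

fromℕ-+ : ∀ a b → fromℕ (a + b) ≡ fromℕ a ℚ.+ fromℕ b
fromℕ-+ a b = sym (begin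
  fromℕ a ℚ.+ fromℕ b                       ≡⟨ cong₂ ℚ._+_ (fromℕ≡mkℚ a) (fromℕ≡mkℚ b) ⟩
  (+ a ℤ.* + 1 ℤ.+ + b ℤ.* + 1) ℚ./ 1       ≡⟨ cong (ℚ._/ 1) (cong₂ ℤ._+_ (ℤ.*-identityʳ (+ a)) (ℤ.*-identityʳ (+ b))) ⟩
  fromℕ (a + b)                             ∎)
  where open ≡-Reasoning

fromℕ-* : ∀ a b → fromℕ (a * b) ≡ fromℕ a ℚ.* fromℕ b
fromℕ-* a b = sym (begin
  fromℕ a ℚ.* fromℕ b                       ≡⟨ cong₂ ℚ._*_ (fromℕ≡mkℚ a) (fromℕ≡mkℚ b) ⟩
  (+ a ℤ.* + b) ℚ./ 1                       ≡⟨ cong (ℚ._/ 1) (ℤ.pos-* a b) ⟨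
  fromℕ (a * b)                             ∎)
  where open ≡-Reasoning

fromℕ-mono-≤ : ∀ {a b} → a ≤ b → fromℕ a ℚ.≤ fromℕ b
fromℕ-mono-≤ {a} {b} a≤b = subst₂ ℚ._≤_ (sym (fromℕ≡mkℚ a)) (sym (fromℕ≡mkℚ b))
  (ℚ.*≤* (subst₂ ℤ._≤_ (sym (ℤ.*-identityʳ (+ a))) (sym (ℤ.*-identityʳ (+ b))) (ℤ.+≤+ a≤b)))

[+a/b]*b≡a : ∀ a b .{{_ : NonZero b}} → (+ a ℚ./ b) ℚ.* fromℕ b ≡ fromℕ a
[+a/b]*b≡a a (suc b-1) = ℚ.toℚᵘ-injective (begin
  ℚ.toℚᵘ ((+ a ℚ./ b) ℚ.* fromℕ b)          ≈⟨ ℚ.toℚᵘ-homo-* (+ a ℚ./ b) (fromℕ b) ⟩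
  ℚ.toℚᵘ (+ a ℚ./ b) ℚᵘ.* ℚ.toℚᵘ (fromℕ b)  ≈⟨ ℚᵘ.*-cong (ℚ.toℚᵘ-fromℚᵘ (mkℚᵘ (+ a) b-1)) (ℚ.toℚᵘ-fromℚᵘ (mkℚᵘ (+ b) 0)) ⟩
  mkℚᵘ (+ a) b-1 ℚᵘ.* mkℚᵘ (+ b) 0        ≈⟨ ℚᵘ.*≡* (trans (ℤ.*-identityʳ _) (sym (cong (λ n → + a ℤ.* + n) (*-identityʳ b)))) ⟩
  mkℚᵘ (+ a) 0                            ≈⟨ ℚ.toℚᵘ-fromℚᵘ (mkℚᵘ (+ a) 0) ⟨
  ℚ.toℚᵘ (fromℕ a)                        ∎)
  where
  b = suc b-1
  open ℚᵘ.≃-Reasoning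

∣floor∣-scaled : ∀ (q : ℚ) a t g .{{_ : NonZero t}} → ℚ.↥ q ℤ.* + suc g ≡ + a → ℚ.↧ q ℤ.* + suc g ≡ + t →
  ℤ.∣ ℚ.floor q ∣ ≡ a / t
∣floor∣-scaled (mkℚ (+ x) d-1 _) a t g ↥q*g≡a ↧q*g≡t = begin
  ℤ.∣ + x ℤ./ + suc d-1 ∣             ≡⟨ cong ℤ.∣_∣ (ℤ.div-pos-is-/ℕ (+ x) (suc d-1)) ⟩
  x / suc d-1                         ≡⟨ m*n/o*n≡m/o x (suc g) (suc d-1) ⟨
  (x * suc g) / (suc d-1 * suc g)     ≡⟨ /-congˡ (ℤ.+-injective (trans (ℤ.pos-* x (suc g)) ↥q*g≡a)) ⟩
  a / (suc d-1 * suc g)               ≡⟨ /-congʳ (ℤ.+-injective (trans (ℤ.pos-* (suc d-1) (suc g)) ↧q*g≡t)) ⟩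
  a / t                               ∎
  where open ≡-Reasoning
∣floor∣-scaled (mkℚ -[1+ x ] d-1 _) a t g () _

∣floor[+a/t]∣≡a/t : ∀ a t .{{_ : NonZero t}} → ℤ.∣ ℚ.floor (+ a ℚ./ t) ∣ ≡ a / t
∣floor[+a/t]∣≡a/t a t = by-gcd (gcd a t) refl
  where
  by-gcd : ∀ k → gcd a t ≡ k → ℤ.∣ ℚ.floor (+ a ℚ./ t) ∣ ≡ a / t
  by-gcd zero gcd≡0 = contradiction gcd≡0 (gcd[m,n]≢0 a t (inj₂ (≢-nonZero⁻¹ t)))
  by-gcd (suc g) gcd≡ = ∣floor∣-scaled (+ a ℚ./ t) a t g
    (trans (cong (λ k → ℚ.↥ (+ a ℚ./ t) ℤ.* + k) (sym gcd≡)) (ℚ.↥-/ (+ a) t))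
    (trans (cong (λ k → ℚ.↧ (+ a ℚ./ t) ℤ.* + k) (sym gcd≡)) (ℚ.↧-/ (+ a) t))

⌊log₂ℚ-invP⌋ : ∀ m t .{{_ : NonZero t}} → ⌊log₂ℚ invP m t ⌋ ≡ ⌊log₂ (2 ^ m / t) ⌋
⌊log₂ℚ-invP⌋ m t = cong ⌊log₂_⌋ (∣floor[+a/t]∣≡a/t (2 ^ m) t)

[p*q]*[r*s]≡[p*r]*[q*s] : ∀ p q r s → p ℚ.* q ℚ.* (r ℚ.* s) ≡ p ℚ.* r ℚ.* (q ℚ.* s)
[p*q]*[r*s]≡[p*r]*[q*s] = solve 4 (λ p q r s → p :* q :* (r :* s) := p :* r :* (q :* s)) refl

½^_ : ℕ → ℚ
½^ zero = 1ℚ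
½^ suc k = ½ ℚ.* ½^ k

½^-+ : ∀ a b → ½^ (a + b) ≡ ½^ a ℚ.* ½^ b
½^-+ zero b = sym (ℚ.*-identityˡ (½^ b))
½^-+ (suc a) b = trans (cong (½ ℚ.*_) (½^-+ a b)) (sym (ℚ.*-assoc ½ (½^ a) (½^ b)))

½^-nonNeg : ∀ k → NonNegative (½^ k)
½^-nonNeg zero = _
½^-nonNeg (suc k) = ℚ.nonNeg*nonNeg⇒nonNeg ½ (½^ k) {{½^-nonNeg k}}

½^*2^ : ∀ k → ½^ k ℚ.* fromℕ (2 ^ k) ≡ 1ℚ
½^*2^ zero = refl
½^*2^ (suc k) = begin
  ½ ℚ.* ½^ k ℚ.* fromℕ (2 * 2 ^ k)              ≡⟨ cong (½ ℚ.* ½^ k ℚ.*_) (fromℕ-* 2 (2 ^ k)) ⟩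
  ½ ℚ.* ½^ k ℚ.* (fromℕ 2 ℚ.* fromℕ (2 ^ k))    ≡⟨ [p*q]*[r*s]≡[p*r]*[q*s] ½ (½^ k) (fromℕ 2) (fromℕ (2 ^ k)) ⟩
  ½ ℚ.* fromℕ 2 ℚ.* (½^ k ℚ.* fromℕ (2 ^ k))    ≡⟨ cong (½ ℚ.* fromℕ 2 ℚ.*_) (½^*2^ k) ⟩
  ½ ℚ.* fromℕ 2 ℚ.* 1ℚ                          ≡⟨⟩
  1ℚ                                            ∎
  where
  open ≡-Reasoning

pOf≡ : ∀ m t → pOf m t ≡ fromℕ t ℚ.* ½^ m
pOf≡ m t = begin
  pOf m t                                   ≡⟨ ℚ.*-identityʳ (pOf m t) ⟨
  pOf m t ℚ.* 1ℚ                            ≡⟨ cong (pOf m t ℚ.*_) (trans (ℚ.*-comm (fromℕ (2 ^ m)) (½^ m)) (½^*2^ m)) ⟨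
  pOf m t ℚ.* (fromℕ (2 ^ m) ℚ.* ½^ m)      ≡⟨ ℚ.*-assoc (pOf m t) _ _ ⟨
  pOf m t ℚ.* fromℕ (2 ^ m) ℚ.* ½^ m        ≡⟨ cong (ℚ._* ½^ m) ([+a/b]*b≡a t (2 ^ m) {{m^n≢0 2 m}}) ⟩
  fromℕ t ℚ.* ½^ m                          ∎
  where open ≡-Reasoning

1-pOf≡ : ∀ m t → t ≤ 2 ^ m → 1ℚ ℚ.- pOf m t ≡ fromℕ (2 ^ m ∸ t) ℚ.* ½^ m
1-pOf≡ m t t≤2^m = begin
  1ℚ ℚ.- pOf m t                                          ≡⟨ cong₂ ℚ._-_ (trans (ℚ.*-comm (fromℕ (2 ^ m)) (½^ m)) (½^*2^ m)) (sym (pOf≡ m t)) ⟨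
  fromℕ (2 ^ m) ℚ.* ½^ m ℚ.- fromℕ t ℚ.* ½^ m             ≡⟨ cong (λ k → fromℕ k ℚ.* ½^ m ℚ.- fromℕ t ℚ.* ½^ m) (m∸n+n≡m t≤2^m) ⟨
  fromℕ (2 ^ m ∸ t + t) ℚ.* ½^ m ℚ.- fromℕ t ℚ.* ½^ m     ≡⟨ cong (λ x → x ℚ.* ½^ m ℚ.- fromℕ t ℚ.* ½^ m) (fromℕ-+ (2 ^ m ∸ t) t) ⟩
  (fromℕ (2 ^ m ∸ t) ℚ.+ fromℕ t) ℚ.* ½^ m ℚ.- fromℕ t ℚ.* ½^ m ≡⟨ cancel (fromℕ (2 ^ m ∸ t)) (fromℕ t) (½^ m) ⟩
  fromℕ (2 ^ m ∸ t) ℚ.* ½^ m                              ∎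
  where
  open ≡-Reasoning
  cancel : ∀ x y w → (x ℚ.+ y) ℚ.* w ℚ.- y ℚ.* w ≡ x ℚ.* w
  cancel = solve 3 (λ x y w → (x :+ y) :* w :- y :* w := x :* w) refl

μ-½ : ∀ {k} (y : Vec Bool k) → μ ½ y ≡ ½^ k
μ-½ [] = refl
μ-½ (true ∷ y) = cong (½ ℚ.*_) (μ-½ y)
μ-½ (false ∷ y) = cong (½ ℚ.*_) (μ-½ y)

μ-pOf : ∀ m t → t ≤ 2 ^ m → ∀ {n} (z : Vec Bool n) → μ (pOf m t) z ≡ fromℕ (fibreSize (h m t) z) ℚ.* ½^ (n * m)
μ-pOf m t t≤2^m [] = refl
μ-pOf m t t≤2^m {suc n} (b ∷ z) = begin
  coordinate b ℚ.* μ (pOf m t) z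
    ≡⟨ cong₂ ℚ._*_ (coordinate≡ b) (μ-pOf m t t≤2^m z) ⟩
  fromℕ (c b) ℚ.* ½^ m ℚ.* (fromℕ (fibreSize (h m t) z) ℚ.* ½^ (n * m))
    ≡⟨ [p*q]*[r*s]≡[p*r]*[q*s] (fromℕ (c b)) (½^ m) (fromℕ (fibreSize (h m t) z)) (½^ (n * m)) ⟩
  fromℕ (c b) ℚ.* fromℕ (fibreSize (h m t) z) ℚ.* (½^ m ℚ.* ½^ (n * m))
    ≡⟨ cong₂ ℚ._*_ (fromℕ-* (c b) (fibreSize (h m t) z)) (½^-+ m (n * m)) ⟨
  fromℕ (fibreSize (h m t) (b ∷ z)) ℚ.* ½^ (m + n * m) ∎
  where
  open ≡-Reasoning
  coordinate : Bool → ℚ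
  coordinate b = if b then pOf m t else 1ℚ ℚ.- pOf m t
  c : Bool → ℕ
  c b = if b then ones (h m t) else zeros (h m t)
  coordinate≡ : ∀ b → coordinate b ≡ fromℕ (c b) ℚ.* ½^ m
  coordinate≡ true = trans (pOf≡ m t) (cong (λ k → fromℕ k ℚ.* ½^ m) (sym (ones-h m t t≤2^m)))
  coordinate≡ false = trans (1-pOf≡ m t t≤2^m) (cong (λ k → fromℕ k ℚ.* ½^ m) (sym (zeros-h m t t≤2^m)))

foldr-map-fromℕ : ∀ {A : Set} {a : A → ℚ} {b : A → ℕ} (Z : ℚ) → (∀ x → a x ≡ fromℕ (b x) ℚ.* Z) →
  ∀ xs → List.foldr ℚ._+_ 0ℚ (map a xs) ≡ fromℕ (sum (map b xs)) ℚ.* Z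
foldr-map-fromℕ Z a≡ List.[] = sym (ℚ.*-zeroˡ Z)
foldr-map-fromℕ {a = a} {b} Z a≡ (x List.∷ xs) = begin
  a x ℚ.+ List.foldr ℚ._+_ 0ℚ (map a xs)        ≡⟨ cong₂ ℚ._+_ (a≡ x) (foldr-map-fromℕ Z a≡ xs) ⟩
  fromℕ (b x) ℚ.* Z ℚ.+ fromℕ S ℚ.* Z           ≡⟨ ℚ.*-distribʳ-+ Z (fromℕ (b x)) (fromℕ S) ⟨
  (fromℕ (b x) ℚ.+ fromℕ S) ℚ.* Z               ≡⟨ cong (ℚ._* Z) (fromℕ-+ (b x) S) ⟨
  fromℕ (b x + S) ℚ.* Z                         ∎
  where
  open ≡-Reasoning
  S = sum (map b xs)

Pr-½ : ∀ k (E : Vec Bool k → Bool) → Pr ½ k E ≡ fromℕ (cubeSum k (bit ∘ E)) ℚ.* ½^ k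
Pr-½ k E = foldr-map-fromℕ (½^ k) pointwise (cube k)
  where
  pointwise : ∀ y → (if E y then μ ½ y else 0ℚ) ≡ fromℕ (bit (E y)) ℚ.* ½^ k
  pointwise y with E y
  ... | true = trans (μ-½ y) (sym (ℚ.*-identityˡ (½^ k)))
  ... | false = sym (ℚ.*-zeroˡ (½^ k))

Pr-pOf : ∀ m t → t ≤ 2 ^ m → ∀ n (E : Vec Bool n → Bool) →
  Pr (pOf m t) n E ≡ fromℕ (weightedSum (h m t) n (bit ∘ E)) ℚ.* ½^ (n * m)
Pr-pOf m t t≤2^m n E = foldr-map-fromℕ (½^ (n * m)) pointwise (cube n)
  where
  pointwise : ∀ z → (if E z then μ (pOf m t) z else 0ℚ) ≡ fromℕ (bit (E z) * fibreSize (h m t) z) ℚ.* ½^ (n * m)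
  pointwise z with E z
  ... | true = trans (μ-pOf m t t≤2^m z) (cong (λ k → fromℕ k ℚ.* ½^ (n * m)) (sym (+-identityʳ (fibreSize (h m t) z))))
  ... | false = sym (ℚ.*-zeroˡ (½^ (n * m)))

sumInfSq-scaled : ∀ p k (F : Vec Bool k → Bool) (c : Fin k → ℕ) Z → (∀ i → Inf p k F i ≡ fromℕ (c i) ℚ.* Z) →
  sumInfSq p k F ≡ fromℕ (finSum k (λ i → c i * c i)) ℚ.* (Z ℚ.* Z)
sumInfSq-scaled p k F c Z Inf≡ = foldr-map-fromℕ (Z ℚ.* Z) square (allFin k)
  where
  square : ∀ i → Inf p k F i ℚ.* Inf p k F i ≡ fromℕ (c i * c i) ℚ.* (Z ℚ.* Z)
  square i = begin
    Inf p k F i ℚ.* Inf p k F i                    ≡⟨ cong (λ x → x ℚ.* x) (Inf≡ i) ⟩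
    fromℕ (c i) ℚ.* Z ℚ.* (fromℕ (c i) ℚ.* Z)      ≡⟨ [p*q]*[r*s]≡[p*r]*[q*s] (fromℕ (c i)) Z (fromℕ (c i)) Z ⟩
    fromℕ (c i) ℚ.* fromℕ (c i) ℚ.* (Z ℚ.* Z)      ≡⟨ cong (ℚ._* (Z ℚ.* Z)) (fromℕ-* (c i) (c i)) ⟨
    fromℕ (c i * c i) ℚ.* (Z ℚ.* Z)                ∎
    where open ≡-Reasoning

divide-by-4^m : ∀ m t L X Y (P : ℚ) → NonNegative P → 2 ^ m * 2 ^ m * X ≤ 12 * (t * t) * L * Y →
  fromℕ X ℚ.* (P ℚ.* P)
    ℚ.≤ fromℕ 12 ℚ.* (fromℕ t ℚ.* ½^ m ℚ.* (fromℕ t ℚ.* ½^ m)) ℚ.* fromℕ L ℚ.* (fromℕ Y ℚ.* (P ℚ.* P))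
divide-by-4^m m t L X Y P P≥0 4^mX≤12t²LY = begin
  fromℕ X ℚ.* (P ℚ.* P)
    ≡⟨ ℚ.*-identityˡ _ ⟨
  1ℚ ℚ.* 1ℚ ℚ.* (fromℕ X ℚ.* (P ℚ.* P))
    ≡⟨ cong (λ u → u ℚ.* u ℚ.* (fromℕ X ℚ.* (P ℚ.* P))) (½^*2^ m) ⟨
  w ℚ.* fromℕ (2 ^ m) ℚ.* (w ℚ.* fromℕ (2 ^ m)) ℚ.* (fromℕ X ℚ.* (P ℚ.* P))
    ≡⟨ pair-up (fromℕ (2 ^ m)) (fromℕ X) w (P ℚ.* P) ⟨
  fromℕ (2 ^ m) ℚ.* fromℕ (2 ^ m) ℚ.* fromℕ X ℚ.* Z
    ≡⟨ cong (ℚ._* Z) (trans (fromℕ-* (2 ^ m * 2 ^ m) X) (cong (ℚ._* fromℕ X) (fromℕ-* (2 ^ m) (2 ^ m)))) ⟨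
  fromℕ (2 ^ m * 2 ^ m * X) ℚ.* Z
    ≤⟨ ℚ.*-monoʳ-≤-nonNeg Z {{Z≥0}} (fromℕ-mono-≤ 4^mX≤12t²LY) ⟩
  fromℕ (12 * (t * t) * L * Y) ℚ.* Z
    ≡⟨ cong (ℚ._* Z) (trans (fromℕ-* (12 * (t * t) * L) Y) (cong (ℚ._* fromℕ Y) (trans (fromℕ-* (12 * (t * t)) L)
         (cong (ℚ._* fromℕ L) (trans (fromℕ-* 12 (t * t)) (cong (fromℕ 12 ℚ.*_) (fromℕ-* t t))))))) ⟩
  fromℕ 12 ℚ.* (fromℕ t ℚ.* fromℕ t) ℚ.* fromℕ L ℚ.* fromℕ Y ℚ.* Z
    ≡⟨ distribute (fromℕ 12) (fromℕ t) (fromℕ L) (fromℕ Y) w (P ℚ.* P) ⟩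
  fromℕ 12 ℚ.* (fromℕ t ℚ.* w ℚ.* (fromℕ t ℚ.* w)) ℚ.* fromℕ L ℚ.* (fromℕ Y ℚ.* (P ℚ.* P)) ∎
  where
  open ℚ.≤-Reasoning
  w = ½^ m
  Z = w ℚ.* w ℚ.* (P ℚ.* P)
  Z≥0 : NonNegative Z
  Z≥0 = ℚ.nonNeg*nonNeg⇒nonNeg (w ℚ.* w) {{ℚ.nonNeg*nonNeg⇒nonNeg w {{½^-nonNeg m}} w {{½^-nonNeg m}}}}
    (P ℚ.* P) {{ℚ.nonNeg*nonNeg⇒nonNeg P {{P≥0}} P {{P≥0}}}}
  pair-up : ∀ k x w q → k ℚ.* k ℚ.* x ℚ.* (w ℚ.* w ℚ.* q) ≡ w ℚ.* k ℚ.* (w ℚ.* k) ℚ.* (x ℚ.* q)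
  pair-up = solve 4 (λ k x w q → k :* k :* x :* (w :* w :* q) := w :* k :* (w :* k) :* (x :* q)) refl
  distribute : ∀ a b c d e f → a ℚ.* (b ℚ.* b) ℚ.* c ℚ.* d ℚ.* (e ℚ.* e ℚ.* f) ≡ a ℚ.* (b ℚ.* e ℚ.* (b ℚ.* e)) ℚ.* c ℚ.* (d ℚ.* f)
  distribute = solve 6 (λ a b c d e f → a :* (b :* b) :* c :* d :* (e :* e :* f) := a :* (b :* e :* (b :* e)) :* c :* (d :* f)) refl

proposition2p6 : (m t n : ℕ) → 1 ≤ m → (ht : 1 ≤ t) → t ≤ 2 ^ (m ∸ 1) → 1 ≤ n →
    (f : Vec Bool n → Bool) →
    sumInfSq (+ 1 ℚ./ 2) (n * m) (Red m t n f)
      ℚ.≤ (+ 12 ℚ./ 1) ℚ.* (pOf m t ℚ.* pOf m t) ℚ.* (+ ⌊log₂ℚ invP m t {{>-nonZero ht}} ⌋ ℚ./ 1)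
          ℚ.* sumInfSq (pOf m t) n f
proposition2p6 (suc m′) t n _ 1≤t t≤2^m′ _ f = begin
  sumInfSq ½ (n * m) (Red m t n f)
    ≡⟨ sumInfSq-scaled ½ (n * m) (Red m t n f) (influenceCount (Red m t n f)) P (λ c → Pr-½ (n * m) _) ⟩
  fromℕ X ℚ.* (P ℚ.* P)
    ≤⟨ divide-by-4^m m t L X Y P (½^-nonNeg (n * m)) (finSum-influenceCount-Red² m t n f 2t≤2^m) ⟩
  fromℕ 12 ℚ.* (fromℕ t ℚ.* ½^ m ℚ.* (fromℕ t ℚ.* ½^ m)) ℚ.* fromℕ L ℚ.* (fromℕ Y ℚ.* (P ℚ.* P))
    ≡⟨ cong₂ (λ p s → fromℕ 12 ℚ.* (p ℚ.* p) ℚ.* fromℕ L ℚ.* s) (pOf≡ m t)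
         (sumInfSq-scaled (pOf m t) n f (biasedInfluenceCount (h m t) f) P (λ i → Pr-pOf m t t≤2^m n _)) ⟨
  fromℕ 12 ℚ.* (pOf m t ℚ.* pOf m t) ℚ.* fromℕ L ℚ.* sumInfSq (pOf m t) n f
    ≡⟨ cong (λ l → fromℕ 12 ℚ.* (pOf m t ℚ.* pOf m t) ℚ.* fromℕ l ℚ.* sumInfSq (pOf m t) n f) (⌊log₂ℚ-invP⌋ m t) ⟨
  fromℕ 12 ℚ.* (pOf m t ℚ.* pOf m t) ℚ.* fromℕ ⌊log₂ℚ invP m t ⌋ ℚ.* sumInfSq (pOf m t) n f ∎
  where
  open ℚ.≤-Reasoning
  m = suc m′
  instance
    t≢0 : NonZero t
    t≢0 = >-nonZero 1≤t
  2t≤2^m : 2 * t ≤ 2 ^ m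
  2t≤2^m = *-monoʳ-≤ 2 t≤2^m′
  t≤2^m : t ≤ 2 ^ m
  t≤2^m = ≤-trans (m≤n*m t 2) 2t≤2^m
  X = finSum (n * m) (λ c → influenceCount (Red m t n f) c * influenceCount (Red m t n f) c)
  Y = finSum n (λ i → biasedInfluenceCount (h m t) f i * biasedInfluenceCount (h m t) f i)
  L = ⌊log₂ (2 ^ m / t) ⌋
  P = ½^ (n * m)
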